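{- Let $P=P_1\cdots P_p$ and $T=T_1\cdots T_t$ be strings over a finite alphabet $\Sigma$, and run the GSM algorithm (described in the context) on $P$ and $T$. For every pair $(r,i)$ with $r\in\{ -1,0,1\}$, $i\in\{1,\dots,p\}$ and $(r,i)\notin\{(-1,1),(1,p)\}$, and for every $j\in\{i,\dots,t\}$ the following holds: if there exists a swap permutation $\pi$ for $P$ such that $\pi(P)_{[1,i]}=T_{[j-i+1,j]}$ and $\pi(i)=i+r$, then $R^j(m_{r,i})=1$.
   Context: For a string $S$ of length $n$, $S_i$ is its $i$-th symbol and $S_{[i,j]}=S_iS_{i+1}\cdots S_j$. A swap permutation for $S$ is a permutation $\pi$ of $\{1,\dots,n\}$ such that (i) $\pi(i)=j$ implies $\pi(j)=i$; (ii) $\pi(i)\in\{i-1,i,i+1\}$ for all $i$; (iii) if $\pi(i)\neq i$ then $S_{\pi(i)}\neq S_i$. The swapped version is $\pi(S)=S_{\pi(1)}S_{\pi(2)}\cdots S_{\pi(n)}$. Bit vectors have length $p$ with bits indexed $1,\dots,p$; $\&$ and $\mid$ are bitwise AND and OR. $\mathit{LShift}(x)$ is the vector with $(\mathit{LShift}(x))_c=x_{c-1}$ for $c\ge 2$ and $(\mathit{LShift}(x))_1=0$; $\mathit{RShift}(x)$ is the vector with $(\mathit{RShift}(x))_c=x_{c+1}$ for $c\le p-1$ and $(\mathit{RShift}(x))_p=0$; $\mathit{LSO}(x)=\mathit{LShift}(x)\mid 1$, i.e. $\mathit{LShift}(x)$ with bit $1$ set to $1$. GSM algorithm: for each $x\in\Sigma$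 let $D^x$ be the vector with $D^x_i=1$ iff $P_i=x$. Set $U^0=M^0=D^0=0^p$ (here $D^j$ with a numeric superscript denotes the state vector, distinct from the masks $D^x$ for symbols $x$). For $j=1,\dots,t$: $U'^j=\mathit{LSO}(D^{j-1})$, $M'^j=\mathit{LSO}(M^{j-1}\mid U^{j-1})$, $D'^j=\mathit{LSO}(M^{j-1}\mid U^{j-1})$; then $U^j=U'^j\,\&\,\mathit{LShift}(D^{T_j})$, $M^j=M'^j\,\&\,D^{T_j}$, $D^j=D'^j\,\&\,\mathit{RShift}(D^{T_j})$; if $U^j_p=1$ or $M^j_p=1$ the algorithm reports a match on position $j-p+1$. Notation: $R^j(m_{r,c})$ denotes $U^j_c$ if $r=-1$, $M^j_c$ if $r=0$, and $D^j_c$ if $r=1$ (the $c$-th bit of the state vector $D^j$). -}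

module Defs where

open import Data.Nat using (ℕ; zero; suc; _<?_)
open import Data.Fin using (Fin; zero; suc; toℕ; fromℕ<)
open import Data.Fin.Permutation using (Permutation′; _⟨$⟩ʳ_)
open import Data.Bool using (Bool; true; false; _∧_; _∨_)
open import Data.Vec using (Vec; lookup; toList)
open import Data.List as List using (List; []; _∷_; foldl)
open import Data.Maybe using (Maybe; just; nothing)
open import Data.Product using (_×_)
open import Data.Sum using (_⊎_)
open import Data.Empty using (⊥)
open import Relation.Nullary using (yes; no; ¬_)
open import Relation.Nullary.Decidable using (⌊_⌋)
open import Relation.Binary.PropositionalEquality using (_≡_)

-- Bit vectors of length p. Bit c (1-based, as in the paper) is stored at
-- the Fin p index c-1.
BV : ℕ → Set
BV p = Fin p → Bool

-- read a bit by 0-based natural index; out-of-range bits read as 0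
get : ∀ {p} → BV p → ℕ → Bool
get {p} x n with n <? p
... | yes h = x (fromℕ< h)
... | no _  = false

zeros : ∀ {p} → BV p
zeros _ = false

_&_ : ∀ {p} → BV p → BV p → BV p
(x & y) c = x c ∧ y c

_∣_ : ∀ {p} → BV p → BV p → BV p
(x ∣ y) c = x c ∨ y c

-- (LShift x)_c = x_{c-1} for c ≥ 2, (LShift x)_1 = 0
LShift : ∀ {p} → BV p → BV p
LShift x zero    = false
LShift x (suc c) = get x (toℕ c)

-- (RShift x)_c = x_{c+1} for c ≤ p-1, (RShift x)_p = 0
RShift : ∀ {p} → BV p → BV p
RShift x c = get x (suc (toℕ c))

LSO : ∀ {p} → BV p → BV p
LSO x zero    = true
LSO x (suc c) = LShift x (suc c)

mask : ∀ {σ p} → Vec (Fin σ) p → Fin σ → BV p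
mask P a i = ⌊ lookup P i Data.Fin.≟ a ⌋

record State (p : ℕ) : Set where
  constructor st
  field
    U : BV p
    M : BV p
    D : BV p
open State public

initial : ∀ {p} → State p
initial = st zeros zeros zeros

step : ∀ {σ p} → Vec (Fin σ) p → State p → Fin σ → State p
step P s a =
  st (LSO (D s) & LShift (mask P a))
     (LSO (M s ∣ U s) & mask P a)
     (LSO (M s ∣ U s) & RShift (mask P a))

run : ∀ {σ p t} → Vec (Fin σ) p → Vec (Fin σ) t → ℕ → State p
run P T j = foldl (step P) initial (List.take j (toList T))

data Row : Set where
  r-1 r0 r+1 : Row

-- R^j(m_{r,c}) for c given as a Fin p (c = toℕ c' + 1)
R : ∀ {σ p t} → Vec (Fin σ) p → Vec (Fin σ) t → ℕ → Row → Fin p → Bool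
R P T j r-1 c = U (run P T j) c
R P T j r0  c = M (run P T j) c
R P T j r+1 c = D (run P T j) c

-- "π(i) = i + r" (both sides shifted to 0-based; shift-invariant)
HasOffset : ∀ {p} → Row → Fin p → Fin p → Set
HasOffset r-1 πi i = suc (toℕ πi) ≡ toℕ i
HasOffset r0  πi i = toℕ πi ≡ toℕ i
HasOffset r+1 πi i = toℕ πi ≡ suc (toℕ i)

Excluded : ∀ {p} → Row → Fin p → Set
Excluded {p} r-1 i = toℕ i ≡ 0
Excluded {p} r0  i = ⊥
Excluded {p} r+1 i = suc (toℕ i) ≡ p

record IsSwapPerm {A : Set} {n : ℕ} (S : Vec A n) (π : Permutation′ n) : Set where
  field
    involutive : ∀ i j → π ⟨$⟩ʳ i ≡ j → π ⟨$⟩ʳ j ≡ i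
    adjacent   : ∀ i → suc (toℕ (π ⟨$⟩ʳ i)) ≡ toℕ i
                       ⊎ toℕ (π ⟨$⟩ʳ i) ≡ toℕ i
                       ⊎ toℕ (π ⟨$⟩ʳ i) ≡ suc (toℕ i)
    differ     : ∀ i → ¬ (π ⟨$⟩ʳ i ≡ i) → ¬ (lookup S (π ⟨$⟩ʳ i) ≡ lookup S i)

atL : ∀ {A : Set} → List A → ℕ → Maybe A
atL []       _       = nothing
atL (x ∷ xs) zero    = just x
atL (x ∷ xs) (suc k) = atL xs k

at : ∀ {A : Set} {n} → Vec A n → ℕ → Maybe A
at v k = atL (toList v) k

module Submission where

-- Fix the swap permutation π and the text position s at which the
-- matched window starts, so that P_{π(k)} = T_{s+k} for every k ≤ i.  We show
-- by induction on i that for every row r with π(i) = i + r the bit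
-- R^{s+i+1}(m_{r,i}) is set.  After reading T_{s+i} = P_{π(i)}:
--   * r = 0 or r = 1: the new bit is LSO(M ∣ U) at i masked by the symbol at
--     π(i); since π(i) ≠ i-1, the involution forces π(i-1) ∈ {i-2, i-1}, so by
--     induction U or M was set at i-1 in the previous step;
--   * r = -1: π(i) = i-1, hence π(i-1) = i, and by induction D was set at i-1.
-- The excluded pairs (r,i) need no special treatment: no permutation of the
-- positions has π(1) = 0 or π(p) = p+1.

open import Defs
open import Data.Nat using (ℕ; zero; suc; _≤_; _+_; _∸_; _<?_)
open import Data.Nat.Properties using (≤-refl; ≤-reflexive; ≤-trans; n≤1+n; +-suc; m∸n+n≡m; suc-injective; 1+n≢n; m≢1+n+m)
open import Data.Fin using (Fin; toℕ; zero; suc; inject₁)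
open import Data.Fin.Properties using (toℕ-injective; toℕ-fromℕ<; toℕ<n; toℕ-inject₁)
open import Data.Fin.Induction using (<-weakInduction)
open import Data.Fin.Permutation using (Permutation′; _⟨$⟩ʳ_)
open import Data.Vec using (Vec; lookup; toList)
open import Data.Bool using (true; _∧_; _∨_)
open import Data.Bool.Properties using (∨-zeroʳ)
open import Data.Maybe using (just)
open import Data.Product using (Σ; _×_; _,_)
open import Data.Sum using (_⊎_; inj₁; inj₂)
open import Data.Unit using (⊤; tt)
open import Data.Empty using (⊥-elim)
open import Data.List as List using (List; []; _∷_; foldl)
open import Relation.Nullary using (¬_; yes; no)
open import Relation.Binary.PropositionalEquality
  using (_≡_; _≢_; refl; sym; trans; cong; subst; module ≡-Reasoning)

∧-intro : ∀ {x y} → x ≡ true → y ≡ true → x ∧ y ≡ true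
∧-intro refl refl = refl

∨-introˡ : ∀ {x y} → x ≡ true → x ∨ y ≡ true
∨-introˡ refl = refl

∨-introʳ : ∀ {x y} → y ≡ true → x ∨ y ≡ true
∨-introʳ {x} refl = ∨-zeroʳ x

get-toℕ : ∀ {p} (x : BV p) (c : Fin p) → get x (toℕ c) ≡ x c
get-toℕ {p} x c with toℕ c <? p
... | yes h = cong x (toℕ-injective (toℕ-fromℕ< h))
... | no h  = ⊥-elim (h (toℕ<n c))

foldl-take-suc : ∀ {A B : Set} (f : B → A → B) (z : B) (xs : List A) (j : ℕ) {a : A} →
                 atL xs j ≡ just a →
                 foldl f z (List.take (suc j) xs) ≡ f (foldl f z (List.take j xs)) a
foldl-take-suc f z []       j       ()
foldl-take-suc f z (x ∷ xs) zero    refl = refl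
foldl-take-suc f z (x ∷ xs) (suc j) e    = foldl-take-suc f (f z x) xs j e

run-suc : ∀ {σ p t} (P : Vec (Fin σ) p) (T : Vec (Fin σ) t) (j : ℕ) {a : Fin σ} →
          at T j ≡ just a → run P T (suc j) ≡ step P (run P T j) a
run-suc P T j = foldl-take-suc (step P) initial (toList T) j

bit : ∀ {p} → Row → State p → BV p
bit r-1 = U
bit r0  = M
bit r+1 = D

R-bit : ∀ {σ p t} (P : Vec (Fin σ) p) (T : Vec (Fin σ) t) (j : ℕ) (r : Row) (c : Fin p) →
        R P T j r c ≡ bit r (run P T j) c
R-bit P T j r-1 c = refl
R-bit P T j r0  c = refl
R-bit P T j r+1 c = refl

-- "The bit of x just before position c is set"; vacuous at the first position,
-- where LSO sets the bit unconditionally.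
Prior : ∀ {n} → BV (suc n) → Fin (suc n) → Set
Prior x zero    = ⊤
Prior x (suc c) = x (inject₁ c) ≡ true

LSO-prior : ∀ {n} (x : BV (suc n)) (c : Fin (suc n)) → Prior x c → LSO x c ≡ true
LSO-prior x zero    _ = refl
LSO-prior x (suc c) e = trans (trans (cong (get x) (sym (toℕ-inject₁ c))) (get-toℕ x (inject₁ c))) e

mask-at : ∀ {σ p} (P : Vec (Fin σ) p) {a : Fin σ} (c : Fin p) → lookup P c ≡ a → mask P a c ≡ true
mask-at P {a} c eq with lookup P c Data.Fin.≟ a
... | yes _ = refl
... | no ne = ⊥-elim (ne eq)

module _ {σ n} (P : Vec (Fin σ) (suc n)) (s : State (suc n)) {a : Fin σ} where

  M-step : (c : Fin (suc n)) → Prior (M s ∣ U s) c → lookup P c ≡ a → M (step P s a) c ≡ true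
  M-step c prior eq = ∧-intro (LSO-prior _ c prior) (mask-at P c eq)

  D-step : (c c⁺ : Fin (suc n)) → toℕ c⁺ ≡ suc (toℕ c) →
           Prior (M s ∣ U s) c → lookup P c⁺ ≡ a → D (step P s a) c ≡ true
  D-step c c⁺ next prior eq =
    ∧-intro (LSO-prior _ c prior)
            (trans (cong (get (mask P a)) (sym next)) (trans (get-toℕ _ c⁺) (mask-at P c⁺ eq)))

  U-step : (c : Fin n) → D s (inject₁ c) ≡ true → lookup P (inject₁ c) ≡ a →
           U (step P s a) (suc c) ≡ true
  U-step c prior eq = ∧-intro (LSO-prior _ (suc c) prior) (LSO-prior _ (suc c) (mask-at P _ eq))

module _ {A : Set} {n : ℕ} {S : Vec A (suc n)} {π : Permutation′ (suc n)}
         (sw : IsSwapPerm S π) (c : Fin n) where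
  open IsSwapPerm sw

  swapped-back : π ⟨$⟩ʳ suc c ≡ inject₁ c → HasOffset r+1 (π ⟨$⟩ʳ inject₁ c) (inject₁ c)
  swapped-back e = trans (cong toℕ (involutive _ _ e)) (cong suc (sym (toℕ-inject₁ c)))

  not-swapped : π ⟨$⟩ʳ suc c ≢ inject₁ c →
                HasOffset r-1 (π ⟨$⟩ʳ inject₁ c) (inject₁ c) ⊎ HasOffset r0 (π ⟨$⟩ʳ inject₁ c) (inject₁ c)
  not-swapped ne with adjacent (inject₁ c)
  ... | inj₁ back         = inj₁ back
  ... | inj₂ (inj₁ stay)  = inj₂ stay
  ... | inj₂ (inj₂ ahead) =
    ⊥-elim (ne (involutive _ _ (toℕ-injective (trans ahead (cong suc (toℕ-inject₁ c))))))

module Invariant {σ n t} (P : Vec (Fin σ) (suc n)) (T : Vec (Fin σ) t)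
                 {π : Permutation′ (suc n)} (sw : IsSwapPerm P π) (s : ℕ) where

  Match : Fin (suc n) → Set
  Match i = ∀ (k : Fin (suc n)) → toℕ k ≤ toℕ i → just (lookup P (π ⟨$⟩ʳ k)) ≡ at T (s + toℕ k)

  before : Fin (suc n) → State (suc n)
  before i = run P T (s + toℕ i)

  Holds : Fin (suc n) → Set
  Holds i = Match i → ∀ r → HasOffset r (π ⟨$⟩ʳ i) i → bit r (run P T (s + suc (toℕ i))) i ≡ true

  match-pred : (c : Fin n) → Match (suc c) → Match (inject₁ c)
  match-pred c mt k k≤c = mt k (≤-trans k≤c (≤-trans (≤-reflexive (toℕ-inject₁ c)) (n≤1+n (toℕ c))))

  run-window : (i : Fin (suc n)) → Match i →
               run P T (s + suc (toℕ i)) ≡ step P (before i) (lookup P (π ⟨$⟩ʳ i))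
  run-window i mt = trans (cong (run P T) (+-suc s (toℕ i))) (run-suc P T (s + toℕ i) (sym (mt i ≤-refl)))

  bit-step : ∀ (i : Fin (suc n)) → Match i → ∀ r →
             bit r (step P (before i) (lookup P (π ⟨$⟩ʳ i))) i ≡ true →
             bit r (run P T (s + suc (toℕ i))) i ≡ true
  bit-step i mt r = subst (λ st → bit r st i ≡ true) (sym (run-window i mt))

  previous : (c : Fin n) → Holds (inject₁ c) → Match (suc c) → ∀ r →
             HasOffset r (π ⟨$⟩ʳ inject₁ c) (inject₁ c) → bit r (before (suc c)) (inject₁ c) ≡ true
  previous c ih mt r off =
    subst (λ m → bit r (run P T (s + suc m)) (inject₁ c) ≡ true) (toℕ-inject₁ c)
          (ih (match-pred c mt) r off)

  prior-MU : (c : Fin n) → Holds (inject₁ c) → Match (suc c) → π ⟨$⟩ʳ suc c ≢ inject₁ c →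
             Prior (M (before (suc c)) ∣ U (before (suc c))) (suc c)
  prior-MU c ih mt ne with not-swapped sw c ne
  ... | inj₁ back = ∨-introʳ (previous c ih mt r-1 back)
  ... | inj₂ stay = ∨-introˡ (previous c ih mt r0 stay)

  lands-on : (c : Fin n) → π ⟨$⟩ʳ suc c ≡ inject₁ c → toℕ (π ⟨$⟩ʳ suc c) ≡ toℕ c
  lands-on c e = trans (cong toℕ e) (toℕ-inject₁ c)

  -- First position: LSO sets its bit, only the symbol has to agree (and π(0) ≠ -1).
  base : Holds zero
  base mt r-1 ()
  base mt r0  off =
    bit-step zero mt r0 (M-step P (before zero) zero tt (cong (lookup P) (sym (toℕ-injective off))))
  base mt r+1 off = bit-step zero mt r+1 (D-step P (before zero) zero (π ⟨$⟩ʳ zero) off tt refl)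

  -- Position c+1: a swap with c uses D at c, any other offset uses M or U at c.
  induction-step : (c : Fin n) → Holds (inject₁ c) → Holds (suc c)
  induction-step c ih mt r-1 off =
    bit-step (suc c) mt r-1
      (U-step P (before (suc c)) c (previous c ih mt r+1 (swapped-back sw c e)) (cong (lookup P) (sym e)))
    where
    e : π ⟨$⟩ʳ suc c ≡ inject₁ c
    e = toℕ-injective (trans (suc-injective off) (sym (toℕ-inject₁ c)))
  induction-step c ih mt r0 off =
    bit-step (suc c) mt r0
      (M-step P (before (suc c)) (suc c) (prior-MU c ih mt ne) (cong (lookup P) (sym (toℕ-injective off))))
    where
    ne : π ⟨$⟩ʳ suc c ≢ inject₁ c
    ne e = 1+n≢n (trans (sym off) (lands-on c e))
  induction-step c ih mt r+1 off =
    bit-step (suc c) mt r+1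
      (D-step P (before (suc c)) (suc c) (π ⟨$⟩ʳ suc c) off (prior-MU c ih mt ne) refl)
    where
    ne : π ⟨$⟩ʳ suc c ≢ inject₁ c
    ne e = m≢1+n+m (toℕ c) {1} (trans (sym (lands-on c e)) off)

  holds : ∀ i → Holds i
  holds = <-weakInduction Holds base induction-step

-- The theorem: take s = j - (i+1), the start of the window in T.  The
-- hypothesis that (r,i) is not excluded is implied by π(i) = i + r.
lemma1 : ∀ {σ p t} (P : Vec (Fin σ) p) (T : Vec (Fin σ) t)
           (r : Row) (i : Fin p) → ¬ Excluded r i →
           (j : ℕ) → suc (toℕ i) ≤ j → j ≤ t →
           Σ (Permutation′ p) (λ π → IsSwapPerm P π
             × (∀ (k : Fin p) → toℕ k ≤ toℕ i →
                  just (lookup P (π ⟨$⟩ʳ k)) ≡ at T (j ∸ suc (toℕ i) + toℕ k))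
             × HasOffset r (π ⟨$⟩ʳ i) i) →
           R P T j r i ≡ true
lemma1 {p = zero}  P T r () _ j i<j _ _
lemma1 {p = suc n} P T r i  _ j i<j _ (π , sw , match , offset) = begin
  R P T j r i                                ≡⟨ cong (λ m → R P T m r i) (sym (m∸n+n≡m i<j)) ⟩
  R P T (s + suc (toℕ i)) r i                ≡⟨ R-bit P T (s + suc (toℕ i)) r i ⟩
  bit r (run P T (s + suc (toℕ i))) i        ≡⟨ holds i match r offset ⟩
  true                                       ∎
  where
  open ≡-Reasoning
  s : ℕ
  s = j ∸ suc (toℕ i)
  open Invariant P T sw s using (holds)
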